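{- Let $q\ge 7$ be an odd prime power, $\Sigma_\infty$ a hyperplane of $\mathrm{PG}(4,q)$, and let $\mathcal C$ be a set of $q^2$ affine points with a set of affine planes ($\mathcal C$-planes) satisfying (A1), (A2), (A3) below. Let $\mathcal A$ be the incidence structure whose points are the points of $\mathcal C$, whose lines are the $\mathcal C$-planes, with incidence inherited (containment). Then $\mathcal A$ is an affine plane of order $q$; consequently there are $q^2+q$ $\mathcal C$-planes, and they fall into $q+1$ parallel classes each consisting of $q$ pairwise parallel $\mathcal C$-planes. (A1) each $\mathcal C$-plane meets $\mathcal C$ in a $q$-arc, and every plane of $\mathrm{PG}(4,q)$ meeting $\mathcal C$ in more than four points is a $\mathcal C$-plane; (A2) any two distinct points of $\mathcal C$ lie in exactly one $\mathcal C$-plane; (A3) each affine point is either in $\mathcal C$, or on no $\mathcal C$-plane, or on exactly two $\mathcal C$-planes.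
   Context: Affine points/lines/planes of $\mathrm{PG}(4,q)$ are those not contained in the hyperplane at infinity $\Sigma_\infty$. A $k$-arc is a set of $k$ points of a plane, no three collinear. Parallel classes are those of the affine plane $\mathcal A$ (two $\mathcal C$-planes are parallel iff equal or sharing no point of $\mathcal C$). -}

module Defs where

open import Level using (0ℓ)
open import Data.Nat as ℕ using (ℕ; suc)
open import Data.Fin using (Fin)
open import Data.Vec using (Vec; replicate; zipWith; foldr)
open import Data.Product using (Σ; ∃; ∃-syntax; _×_; _,_)
open import Data.Sum using (_⊎_)
open import Relation.Binary.PropositionalEquality using (_≡_; _≢_)
open import Relation.Nullary using (¬_)
open import Function using (_↔_; Injective)
open import Algebra.Structures using (IsCommutativeRing)

record Field : Set₁ where
  infixl 6 _+_
  infixl 7 _*_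
  field
    Carrier : Set
    _+_ _*_ : Carrier → Carrier → Carrier
    -_      : Carrier → Carrier
    0# 1#   : Carrier
    isCommutativeRing : IsCommutativeRing _≡_ _+_ _*_ -_ 0# 1#
    0≢1     : 0# ≢ 1#
    inverse : ∀ x → x ≢ 0# → ∃[ y ] (x * y ≡ 1#)

HasOrder : Field → ℕ → Set
HasOrder F q = Fin q ↔ Field.Carrier F

Odd : ℕ → Set
Odd n = ∃[ k ] (n ≡ suc (2 ℕ.* k))

-- The projective space PG(4,F), via homogeneous coordinates in F^5

module PG4 (F : Field) where
  open Field F

  V : Set
  V = Vec Carrier 5

  _·_ : Carrier → V → V
  c · v = Data.Vec.map (c *_) v

  _⊕_ : V → V → V
  _⊕_ = zipWith _+_

  𝟎 : V
  𝟎 = replicate 5 0#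

  dot : V → V → Carrier
  dot u v = foldr (λ _ → Carrier) _+_ 0# (zipWith _*_ u v)

  record Point : Set where
    constructor pt
    field
      vec    : V
      nonzero : vec ≢ 𝟎
  open Point public

  SamePoint : Point → Point → Set
  SamePoint P Q = ∃[ c ] (c ≢ 0# × vec P ≡ c · vec Q)

  record Line : Set where
    field
      u₁ u₂ : V
      indep : ∀ a b → (a · u₁) ⊕ (b · u₂) ≡ 𝟎 → a ≡ 0# × b ≡ 0#

  OnLine : Point → Line → Set
  OnLine P ℓ = ∃[ a ] ∃[ b ] (vec P ≡ (a · Line.u₁ ℓ) ⊕ (b · Line.u₂ ℓ))

  Collinear : Point → Point → Point → Set
  Collinear P Q R = ∃[ ℓ ] (OnLine P ℓ × OnLine Q ℓ × OnLine R ℓ)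

  record Plane : Set where
    field
      u₁ u₂ u₃ : V
      indep : ∀ a b c → ((a · u₁) ⊕ (b · u₂)) ⊕ (c · u₃) ≡ 𝟎
              → a ≡ 0# × b ≡ 0# × c ≡ 0#

  OnPlane : Point → Plane → Set
  OnPlane P π = ∃[ a ] ∃[ b ] ∃[ c ]
    (vec P ≡ ((a · Plane.u₁ π) ⊕ (b · Plane.u₂ π)) ⊕ (c · Plane.u₃ π))

  SamePlane : Plane → Plane → Set
  SamePlane π ρ = ∀ P → (OnPlane P π → OnPlane P ρ) × (OnPlane P ρ → OnPlane P π)

  -- the hyperplane at infinity Σ∞ is given by a nonzero linear form h:
  -- Σ∞ = { ⟨x⟩ : dot h x = 0 }
  module Affine (h : V) where
    Affine : Point → Set
    Affine P = dot h (vec P) ≢ 0#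

    AffinePlane : Plane → Set
    AffinePlane π = ∃[ P ] (OnPlane P π × Affine P)

module Incidence
  {Pt Ln : Set} (_≈L_ : Ln → Ln → Set) (_I_ : Pt → Ln → Set) where

  Parallel : Ln → Ln → Set
  Parallel ℓ m = ℓ ≈L m ⊎ (∀ P → ¬ (P I ℓ × P I m))

  CollinearPts : Pt → Pt → Pt → Set
  CollinearPts P Q R = ∃[ ℓ ] (P I ℓ × Q I ℓ × R I ℓ)

  record IsAffinePlaneOfOrder (n : ℕ) : Set where
    field
      join    : ∀ P Q → P ≢ Q → ∃[ ℓ ] (P I ℓ × Q I ℓ)
      joinUniq : ∀ P Q → P ≢ Q → ∀ ℓ m → P I ℓ → Q I ℓ → P I m → Q I m → ℓ ≈L m
      parallel : ∀ P ℓ → ¬ (P I ℓ) → ∃[ m ] (P I m × Parallel ℓ m)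
      parallelUniq : ∀ P ℓ → ¬ (P I ℓ) → ∀ m m′ → P I m → Parallel ℓ m
                     → P I m′ → Parallel ℓ m′ → m ≈L m′
      nondegenerate : ∃[ P ] ∃[ Q ] ∃[ R ] (¬ CollinearPts P Q R)
      order : ∀ ℓ → Σ (Fin n → Pt) λ g → Injective _≡_ _≡_ g
              × (∀ j → g j I ℓ) × (∀ P → P I ℓ → ∃[ j ] (g j ≡ P))

module Setting (F : Field) (q : ℕ) (h : PG4.V F)
               (c : Fin (q ℕ.* q) → PG4.Point F)
               (isC : PG4.Plane F → Set) where
  open Field F
  open PG4 F
  open PG4.Affine F h

  InC : Point → Set
  InC P = ∃[ i ] SamePoint P (c i)

  MeetsInQArc : Plane → Set
  MeetsInQArc π = Σ (Fin q → Fin (q ℕ.* q)) λ g → Injective _≡_ _≡_ g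
    × (∀ j → OnPlane (c (g j)) π)
    × (∀ i → OnPlane (c i) π → ∃[ j ] (g j ≡ i))
    × (∀ j₁ j₂ j₃ → j₁ ≢ j₂ → j₁ ≢ j₃ → j₂ ≢ j₃
         → ¬ Collinear (c (g j₁)) (c (g j₂)) (c (g j₃)))

  MeetsInMoreThanFour : Plane → Set
  MeetsInMoreThanFour π = Σ (Fin 5 → Fin (q ℕ.* q)) λ g → Injective _≡_ _≡_ g
    × (∀ j → OnPlane (c (g j)) π)

  A1 : Set
  A1 = (∀ π → isC π → MeetsInQArc π)
     × (∀ π → MeetsInMoreThanFour π → isC π)

  A2 : Set
  A2 = ∀ i j → i ≢ j → ∃[ π ] (isC π × OnPlane (c i) π × OnPlane (c j) π
        × (∀ ρ → isC ρ → OnPlane (c i) ρ → OnPlane (c j) ρ → SamePlane π ρ))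

  A3 : Set
  A3 = ∀ P → Affine P →
         InC P
       ⊎ (∀ π → isC π → ¬ OnPlane P π)
       ⊎ (∃[ π₁ ] ∃[ π₂ ] (isC π₁ × isC π₂ × OnPlane P π₁ × OnPlane P π₂
            × ¬ SamePlane π₁ π₂
            × (∀ π → isC π → OnPlane P π → SamePlane π π₁ ⊎ SamePlane π π₂)))

  CLine : Set
  CLine = Σ Plane isC

  _≈L_ : CLine → CLine → Set
  (π , _) ≈L (ρ , _) = SamePlane π ρ

  _I_ : Fin (q ℕ.* q) → CLine → Set
  i I (π , _) = OnPlane (c i) π

  open Incidence _≈L_ _I_ public

  NumberOfCPlanes : Set
  NumberOfCPlanes = Σ (Fin (q ℕ.* q ℕ.+ q) → CLine) λ e
    → (∀ a b → e a ≈L e b → a ≡ b) × (∀ ℓ → ∃[ a ] (ℓ ≈L e a))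

  -- the 𝒞-planes fall into q+1 parallel classes of q pairwise parallel planes:
  -- L a b is the b-th plane of the a-th class
  ParallelClasses : Set
  ParallelClasses = Σ (Fin (suc q) → Fin q → CLine) λ L
    → (∀ a b a′ b′ → L a b ≈L L a′ b′ → a ≡ a′ × b ≡ b′)
    × (∀ ℓ → ∃[ a ] ∃[ b ] (ℓ ≈L L a b))
    × (∀ a b a′ b′ → (Parallel (L a b) (L a′ b′) → a ≡ a′)
                     × (a ≡ a′ → Parallel (L a b) (L a′ b′)))

-- A linear space on n²
-- points whose lines all have n points is an affine plane of order n: for P off a line ℓ, the
-- n lines joining P to ℓ cover only n(n − 1) + 1 < n² points, so some line through P misses ℓ,
-- while two such lines together with those n would be n + 2 lines through P, covering
-- (n + 2)(n − 1) + 1 > n² points. Parallelism is then an equivalence relation; the n + 1 lines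
-- through a fixed point represent its classes, and a line outside a class meets each of its
-- n members exactly once. This gives q + 1 classes of q lines, hence q² + q lines in all.
module Submission where

open import Level using (0ℓ)
open import Data.Nat as ℕ using (ℕ; suc; z≤n; s≤s; _*_; _+_; _≤_; _<_)
open import Data.Nat.Properties using (m<m+n; +-comm; <⇒≱)
open import Data.Nat.Tactic.RingSolver using (solve-∀)
open import Data.Fin using (Fin; zero; suc; punchIn; punchOut; _≟_)
open import Data.Fin.Properties
  using (0≢1+n; punchIn-injective; punchInᵢ≢i; punchOut-injective; injective⇒≤; any?; all?; ¬∀⟶∃¬; *↔×)
open import Data.Vec.Functional using (_∷_)
open import Data.Product using (Σ; ∃-syntax; _×_; _,_; proj₁; proj₂; uncurry; swap)
open import Data.Product.Properties using (×-≡,≡→≡)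
open import Data.Sum using (inj₁; inj₂)
open import Data.Empty using (⊥-elim)
open import Relation.Nullary using (¬_; Dec; yes; no)
open import Relation.Nullary.Decidable using (_×-dec_; ¬?)
open import Relation.Binary using (Rel; IsEquivalence)
import Relation.Binary.Construct.On as On
open import Relation.Binary.PropositionalEquality using (_≡_; _≢_; refl; sym; trans; cong; subst)
open import Function using (_∘_; id; _↔_; Injective; Inverse; Injection)
open import Function.Properties.Inverse using (↔⇒↣; ↔-sym)

open import Defs

injective⇒≤-from-× : ∀ {k l M} {f : Fin k × Fin l → Fin M}
  → Injective _≡_ _≡_ f → k * l ≤ M
injective⇒≤-from-× {k} {l} f-inj =
  injective⇒≤ (Injection.injective (↔⇒↣ (*↔× {k} {l})) ∘ f-inj)

injective⇒≤-into-× : ∀ {k l M} {f : Fin M → Fin k × Fin l}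
  → Injective _≡_ _≡_ f → M ≤ k * l
injective⇒≤-into-× {k} {l} f-inj =
  injective⇒≤ (f-inj ∘ Injection.injective (↔⇒↣ (↔-sym (*↔× {k} {l}))))

-- k + k * suc k is pred ((1 + k)²), the number of points other than a given one.
pred-square≡ : ∀ k → k + k * suc k ≡ suc k * k + k
pred-square≡ = solve-∀

pred-square+≡ : ∀ k → suc (suc (suc k)) * k ≡ (k + k * suc k) + k
pred-square+≡ = solve-∀

module FiniteLinearSpace
  (m : ℕ) {Ln : Set} (_≈_ : Rel Ln 0ℓ) (≈-isEquivalence : IsEquivalence _≈_)
  (_I_ : Fin (suc (suc m) * suc (suc m)) → Ln → Set)
  (I-resp-≈ : ∀ {P ℓ ℓ′} → ℓ ≈ ℓ′ → P I ℓ → P I ℓ′)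
  (point : Ln → Fin (suc (suc m)) → Fin (suc (suc m) * suc (suc m)))
  (point-injective : ∀ ℓ → Injective _≡_ _≡_ (point ℓ))
  (point-on : ∀ ℓ j → point ℓ j I ℓ)
  (point-surjective : ∀ ℓ P → P I ℓ → ∃[ j ] (point ℓ j ≡ P))
  (join : ∀ P Q → P ≢ Q → ∃[ ℓ ] (P I ℓ × Q I ℓ))
  (join-unique : ∀ P Q → P ≢ Q → ∀ ℓ ℓ′ → P I ℓ → Q I ℓ → P I ℓ′ → Q I ℓ′ → ℓ ≈ ℓ′)
  where

  open IsEquivalence ≈-isEquivalence
    renaming (refl to ≈-refl; sym to ≈-sym; trans to ≈-trans)
  open Incidence _≈_ _I_

  private
    n n′ : ℕ
    n = suc (suc m)
    n′ = suc m

  Pt : Set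
  Pt = Fin (n * n)

  -- Here, in point-off and in Rays.parallel-exists, searches over all n² points are kept abstract:
  -- unfolding them during type checking exhausts memory.
  abstract
    I? : ∀ P ℓ → Dec (P I ℓ)
    I? P ℓ with any? (λ j → point ℓ j ≟ P)
    ... | yes (j , j↦P) = yes (subst (_I ℓ) j↦P (point-on ℓ j))
    ... | no ∄j = no (∄j ∘ point-surjective ℓ P)

  index : ∀ {P} ℓ → P I ℓ → Fin n
  index ℓ P∈ℓ = proj₁ (point-surjective ℓ _ P∈ℓ)

  point-index : ∀ {P} ℓ (P∈ℓ : P I ℓ) → point ℓ (index ℓ P∈ℓ) ≡ P
  point-index ℓ P∈ℓ = proj₂ (point-surjective ℓ _ P∈ℓ)

  point-index-I : ∀ {P m} ℓ (P∈ℓ : P I ℓ) → P I m → point ℓ (index ℓ P∈ℓ) I m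
  point-index-I ℓ P∈ℓ P∈m = subst (_I _) (sym (point-index ℓ P∈ℓ)) P∈m

  index-injective : ∀ {P Q} ℓ (P∈ℓ : P I ℓ) (Q∈ℓ : Q I ℓ) → index ℓ P∈ℓ ≡ index ℓ Q∈ℓ → P ≡ Q
  index-injective ℓ P∈ℓ Q∈ℓ eq =
    trans (sym (point-index ℓ P∈ℓ)) (trans (cong (point ℓ) eq) (point-index ℓ Q∈ℓ))

  another-point : ∀ ℓ P → ∃[ R ] (R ≢ P × R I ℓ)
  another-point ℓ P with point ℓ zero ≟ P
  ... | no point₀≢P = point ℓ zero , point₀≢P , point-on ℓ zero
  ... | yes point₀≡P = point ℓ (suc zero)
                     , (λ point₁≡P → 0≢1+n (point-injective ℓ (trans point₀≡P (sym point₁≡P))))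
                , point-on ℓ (suc zero)

  abstract
    point-off : ∀ ℓ → ∃[ R ] ¬ R I ℓ
    point-off ℓ with all? (λ R → I? R ℓ)
    ... | yes all-on = ⊥-elim (<⇒≱ (m<m+n n (s≤s z≤n))
            (injective⇒≤ (index-injective ℓ (all-on _) (all-on _))))
    ... | no ¬all-on = ¬∀⟶∃¬ _ _ (λ R → I? R ℓ) ¬all-on

  ∷-injective : ∀ {k ℓ} {L : Fin k → Ln}
    → (∀ a → ¬ ℓ ≈ L a) → Injective _≡_ _≈_ L → Injective _≡_ _≈_ (ℓ ∷ L)
  ∷-injective ℓ∉L L-inj {zero} {zero} _ = refl
  ∷-injective ℓ∉L L-inj {zero} {suc b} e = ⊥-elim (ℓ∉L b e)
  ∷-injective ℓ∉L L-inj {suc a} {zero} e = ⊥-elim (ℓ∉L a (≈-sym e))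
  ∷-injective ℓ∉L L-inj {suc a} {suc b} e = cong suc (L-inj e)

  -- Distinct lines through P share no other point, so each contributes n − 1 points besides P.
  module Concurrent {k} (P : Pt) (L : Fin k → Ln) (P∈L : ∀ a → P I L a)
                    (L-injective : Injective _≡_ _≈_ L) where

    private
      at : Fin k → Fin n
      at a = index (L a) (P∈L a)

      other : Fin k → Fin n′ → Pt
      other a t = point (L a) (punchIn (at a) t)

      P≢other : ∀ a t → P ≢ other a t
      P≢other a t P≡ = punchInᵢ≢i (at a) t
        (point-injective (L a) (trans (sym P≡) (sym (point-index (L a) (P∈L a)))))

      other-injective : ∀ {a t a′ t′} → other a t ≡ other a′ t′ → (a , t) ≡ (a′ , t′)
      other-injective {a} {t} {a′} {t′} eq
        with refl ← L-injective (join-unique P (other a t) (P≢other a t) (L a) (L a′)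
               (P∈L a) (point-on _ _) (P∈L a′) (subst (_I L a′) (sym eq) (point-on _ _)))
        = cong (a ,_) (punchIn-injective (at a) t t′ (point-injective (L a) eq))

      coordinates : ∀ {R} a → R I L a → R ≢ P → Fin k × Fin n′
      coordinates a R∈ R≢P =
        a , punchOut {i = at a} (R≢P ∘ sym ∘ index-injective (L a) (P∈L a) R∈)

      coordinates-injective : ∀ {R R′ a a′} {R∈ : R I L a} {R′∈ : R′ I L a′} {R≢P R′≢P}
        → coordinates a R∈ R≢P ≡ coordinates a′ R′∈ R′≢P → R ≡ R′
      coordinates-injective {a = a} {R∈ = R∈} {R′∈} eq with refl ← cong proj₁ eq =
        index-injective (L a) R∈ R′∈ (punchOut-injective {i = at a} _ _ (cong proj₂ eq))

    count-≤ : k * n′ ≤ ℕ.pred (n * n)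
    count-≤ = injective⇒≤-from-× {f = λ (a , t) → punchOut (P≢other a t)}
      (other-injective ∘ punchOut-injective {i = P} _ _)

    covering-count-≥ : (∀ R → ∃[ a ] (R I L a)) → ℕ.pred (n * n) ≤ k * n′
    covering-count-≥ cover = injective⇒≤-into-× {f = f} f-injective
      where
      f : Fin (ℕ.pred (n * n)) → Fin k × Fin n′
      f R′ = coordinates (proj₁ (cover (punchIn P R′))) (proj₂ (cover (punchIn P R′)))
                         (punchInᵢ≢i P R′)

      f-injective : Injective _≡_ _≡_ f
      f-injective {R′} {R″} = punchIn-injective P R′ R″
        ∘ coordinates-injective {R≢P = punchInᵢ≢i P R′} {punchInᵢ≢i P R″}

  n-concurrent-lines-do-not-cover : ∀ P (L : Fin n → Ln) → (∀ a → P I L a)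
    → Injective _≡_ _≈_ L → ¬ (∀ R → ∃[ a ] (R I L a))
  n-concurrent-lines-do-not-cover P L P∈L L-inj cover =
    <⇒≱ (subst (n * n′ <_) (sym (pred-square≡ n′)) (m<m+n (n * n′) (s≤s z≤n)))
        (Concurrent.covering-count-≥ P L P∈L L-inj cover)

  no-n+2-concurrent-lines : ∀ P (L : Fin (suc (suc n)) → Ln) → (∀ a → P I L a)
    → ¬ Injective _≡_ _≈_ L
  no-n+2-concurrent-lines P L P∈L L-inj =
    <⇒≱ (subst (ℕ.pred (n * n) <_) (sym (pred-square+≡ n′)) (m<m+n _ (s≤s z≤n)))
        (Concurrent.count-≤ P L P∈L L-inj)

  parallel-refl : ∀ {ℓ} → Parallel ℓ ℓ
  parallel-refl = inj₁ ≈-refl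

  parallel-sym : ∀ {ℓ m} → Parallel ℓ m → Parallel m ℓ
  parallel-sym (inj₁ ℓ≈m) = inj₁ (≈-sym ℓ≈m)
  parallel-sym (inj₂ disjoint) = inj₂ λ R (R∈m , R∈ℓ) → disjoint R (R∈ℓ , R∈m)

  parallel-respʳ-≈ : ∀ {ℓ m m′} → m ≈ m′ → Parallel ℓ m → Parallel ℓ m′
  parallel-respʳ-≈ m≈m′ (inj₁ ℓ≈m) = inj₁ (≈-trans ℓ≈m m≈m′)
  parallel-respʳ-≈ m≈m′ (inj₂ disjoint) =
    inj₂ λ R (R∈ℓ , R∈m′) → disjoint R (R∈ℓ , I-resp-≈ (≈-sym m≈m′) R∈m′)

  parallel-meet⇒≈ : ∀ {ℓ m P} → Parallel ℓ m → P I ℓ → P I m → ℓ ≈ m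
  parallel-meet⇒≈ (inj₁ ℓ≈m) _ _ = ℓ≈m
  parallel-meet⇒≈ {P = P} (inj₂ disjoint) P∈ℓ P∈m = ⊥-elim (disjoint P (P∈ℓ , P∈m))

  meet? : ∀ ℓ m → Dec (∃[ R ] (R I ℓ × R I m))
  meet? ℓ m = any? (λ R → I? R ℓ ×-dec I? R m)

  module Rays (P : Pt) (ℓ : Ln) (P∉ℓ : ¬ P I ℓ) where

    private
      P≢point : ∀ j → P ≢ point ℓ j
      P≢point j P≡ = P∉ℓ (subst (_I ℓ) (sym P≡) (point-on ℓ j))

    ray : Fin n → Ln
    ray j = proj₁ (join P (point ℓ j) (P≢point j))

    P∈ray : ∀ j → P I ray j
    P∈ray j = proj₁ (proj₂ (join P (point ℓ j) (P≢point j)))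

    point∈ray : ∀ j → point ℓ j I ray j
    point∈ray j = proj₂ (proj₂ (join P (point ℓ j) (P≢point j)))

    ray-unique : ∀ {j m} → P I m → point ℓ j I m → m ≈ ray j
    ray-unique {j} {m} P∈m j∈m =
      join-unique P (point ℓ j) (P≢point j) m (ray j) P∈m j∈m (P∈ray j) (point∈ray j)

    ray-injective : Injective _≡_ _≈_ ray
    ray-injective {i} {j} ray-i≈j with i ≟ j
    ... | yes i≡j = i≡j
    ... | no i≢j = ⊥-elim (P∉ℓ (I-resp-≈ ray-i≈ℓ (P∈ray i)))
      where
      ray-i≈ℓ : ray i ≈ ℓ
      ray-i≈ℓ = join-unique (point ℓ i) (point ℓ j) (i≢j ∘ point-injective ℓ) (ray i) ℓ
        (point∈ray i) (I-resp-≈ (≈-sym ray-i≈j) (point∈ray j)) (point-on ℓ i) (point-on ℓ j)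

    ray-not-parallel : ∀ {j m} → Parallel ℓ m → ¬ m ≈ ray j
    ray-not-parallel {j} ℓ∥m m≈ray with parallel-respʳ-≈ m≈ray ℓ∥m
    ... | inj₁ ℓ≈ray = P∉ℓ (I-resp-≈ (≈-sym ℓ≈ray) (P∈ray j))
    ... | inj₂ disjoint = disjoint (point ℓ j) (point-on ℓ j , point∈ray j)

    private
      on-ray? : ∀ R → Dec (∃[ j ] (R I ray j))
      on-ray? R = any? (λ j → I? R (ray j))

      parallel-through-off-rays : ∃[ R ] ¬ (∃[ j ] (R I ray j)) → ∃[ m ] (P I m × Parallel ℓ m)
      parallel-through-off-rays (R , R∉rays) with join P R (λ { refl → R∉rays (zero , P∈ray zero) })
      ... | m , P∈m , R∈m = m , P∈m , inj₂ λ Q (Q∈ℓ , Q∈m) →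
        R∉rays (index ℓ Q∈ℓ , I-resp-≈ (ray-unique P∈m (point-index-I ℓ Q∈ℓ Q∈m)) R∈m)

    abstract
      parallel-exists : ∃[ m ] (P I m × Parallel ℓ m)
      parallel-exists with all? on-ray?
      ... | yes covered = ⊥-elim (n-concurrent-lines-do-not-cover P ray P∈ray ray-injective covered)
      ... | no ¬covered = parallel-through-off-rays (¬∀⟶∃¬ _ _ on-ray? ¬covered)

    parallel-unique : ∀ {m m′} → P I m → Parallel ℓ m → P I m′ → Parallel ℓ m′ → m ≈ m′
    parallel-unique {m} {m′} P∈m ℓ∥m P∈m′ ℓ∥m′
      with any? (λ R → ¬? (R ≟ P) ×-dec (I? R m ×-dec I? R m′))
    ... | yes (R , R≢P , R∈m , R∈m′) = join-unique P R (R≢P ∘ sym) m m′ P∈m R∈m P∈m′ R∈m′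
    ... | no ∄R = ⊥-elim (no-n+2-concurrent-lines P (m′ ∷ m ∷ ray)
                    (λ { zero → P∈m′ ; (suc zero) → P∈m ; (suc (suc j)) → P∈ray j })
                    (∷-injective m′∉ (∷-injective (λ _ → ray-not-parallel ℓ∥m) ray-injective)))
      where
      m′≉m : ¬ m′ ≈ m
      m′≉m m′≈m with another-point m′ P
      ... | R , R≢P , R∈m′ = ∄R (R , R≢P , I-resp-≈ m′≈m R∈m′ , R∈m′)

      m′∉ : ∀ a → ¬ m′ ≈ (m ∷ ray) a
      m′∉ zero = m′≉m
      m′∉ (suc j) = ray-not-parallel ℓ∥m′

  parallel-through : ∀ P ℓ → ∃[ m ] (P I m × Parallel ℓ m)
  parallel-through P ℓ with I? P ℓ
  ... | yes P∈ℓ = ℓ , P∈ℓ , parallel-refl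
  ... | no P∉ℓ = Rays.parallel-exists P ℓ P∉ℓ

  parallel-through-unique : ∀ {P ℓ m m′} → P I m → Parallel ℓ m → P I m′ → Parallel ℓ m′ → m ≈ m′
  parallel-through-unique {P} {ℓ} P∈m ℓ∥m P∈m′ ℓ∥m′ with I? P ℓ
  ... | yes P∈ℓ = ≈-trans (≈-sym (parallel-meet⇒≈ ℓ∥m P∈ℓ P∈m)) (parallel-meet⇒≈ ℓ∥m′ P∈ℓ P∈m′)
  ... | no P∉ℓ = Rays.parallel-unique P ℓ P∉ℓ P∈m ℓ∥m P∈m′ ℓ∥m′

  parallel-trans : ∀ {ℓ m k} → Parallel ℓ m → Parallel m k → Parallel ℓ k
  parallel-trans {ℓ} {m} {k} ℓ∥m m∥k with meet? ℓ k
  ... | yes (P , P∈ℓ , P∈k) = inj₁ (parallel-through-unique P∈ℓ (parallel-sym ℓ∥m) P∈k m∥k)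
  ... | no ∄P = inj₂ λ P P∈ℓk → ∄P (P , P∈ℓk)

  module Transversal (ℓ t : Ln) (ℓ∦t : ¬ Parallel ℓ t) where

    member : Fin n → Ln
    member b = proj₁ (parallel-through (point t b) ℓ)

    point∈member : ∀ b → point t b I member b
    point∈member b = proj₁ (proj₂ (parallel-through (point t b) ℓ))

    member-parallel : ∀ b → Parallel ℓ (member b)
    member-parallel b = proj₂ (proj₂ (parallel-through (point t b) ℓ))

    member-injective : Injective _≡_ _≈_ member
    member-injective {b} {b′} member-b≈b′ with b ≟ b′
    ... | yes b≡b′ = b≡b′
    ... | no b≢b′ = ⊥-elim (ℓ∦t (parallel-respʳ-≈ member-b≈t (member-parallel b)))
      where
      member-b≈t : member b ≈ t
      member-b≈t = join-unique (point t b) (point t b′) (b≢b′ ∘ point-injective t) (member b) t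
        (point∈member b) (I-resp-≈ (≈-sym member-b≈b′) (point∈member b′))
        (point-on t b) (point-on t b′)

    member-surjective : ∀ {m} → Parallel ℓ m → ∃[ b ] (m ≈ member b)
    member-surjective {m} ℓ∥m with meet? m t
    ... | yes (R , R∈m , R∈t) = index t R∈t ,
          parallel-through-unique (point-index-I t R∈t R∈m) ℓ∥m
                                  (point∈member (index t R∈t)) (member-parallel (index t R∈t))
    ... | no ∄R = ⊥-elim (ℓ∦t (parallel-trans ℓ∥m (inj₂ λ R R∈mt → ∄R (R , R∈mt))))

  private
    ℓ₀ : Ln
    ℓ₀ = proj₁ (join zero (suc zero) λ ())

    0∈ℓ₀ : zero I ℓ₀
    0∈ℓ₀ = proj₁ (proj₂ (join zero (suc zero) λ ()))

    1∈ℓ₀ : suc zero I ℓ₀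
    1∈ℓ₀ = proj₂ (proj₂ (join zero (suc zero) λ ()))

    O : Pt
    O = proj₁ (point-off ℓ₀)

    O∉ℓ₀ : ¬ O I ℓ₀
    O∉ℓ₀ = proj₂ (point-off ℓ₀)

  isAffinePlane : IsAffinePlaneOfOrder n
  isAffinePlane = record
    { join = join
    ; joinUniq = join-unique
    ; parallel = Rays.parallel-exists
    ; parallelUniq = λ P ℓ P∉ℓ _ _ → Rays.parallel-unique P ℓ P∉ℓ
    ; nondegenerate = zero , suc zero , O , λ (m , 0∈m , 1∈m , O∈m) →
        O∉ℓ₀ (I-resp-≈ (join-unique zero (suc zero) (λ ()) m ℓ₀ 0∈m 1∈m 0∈ℓ₀ 1∈ℓ₀) O∈m)
    ; order = λ ℓ → point ℓ , point-injective ℓ , point-on ℓ , point-surjective ℓ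
    }

  private
    open Rays O ℓ₀ O∉ℓ₀

    direction : Fin (suc n) → Ln
    direction = proj₁ parallel-exists ∷ ray

    O∈direction : ∀ a → O I direction a
    O∈direction zero = proj₁ (proj₂ parallel-exists)
    O∈direction (suc j) = P∈ray j

    direction-injective : Injective _≡_ _≈_ direction
    direction-injective =
      ∷-injective (λ _ → ray-not-parallel (proj₂ (proj₂ parallel-exists))) ray-injective

    direction-surjective : ∀ {m} → O I m → ∃[ a ] (m ≈ direction a)
    direction-surjective {m} O∈m with any? (λ j → I? (point ℓ₀ j) m)
    ... | yes (j , j∈m) = suc j , ray-unique O∈m j∈m
    ... | no ∄j =
      zero , parallel-unique O∈m (inj₂ ℓ₀∥m) (O∈direction zero) (proj₂ (proj₂ parallel-exists))
      where
      ℓ₀∥m : ∀ R → ¬ (R I ℓ₀ × R I m)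
      ℓ₀∥m R (R∈ℓ₀ , R∈m) = ∄j (index ℓ₀ R∈ℓ₀ , point-index-I ℓ₀ R∈ℓ₀ R∈m)

    direction-of : ∀ ℓ → ∃[ a ] Parallel (direction a) ℓ
    direction-of ℓ with parallel-through O ℓ
    ... | m , O∈m , ℓ∥m with direction-surjective O∈m
    ... | a , m≈a = a , parallel-sym (parallel-respʳ-≈ m≈a ℓ∥m)

    parallel-directions⇒≡ : ∀ {a a′} → Parallel (direction a) (direction a′) → a ≡ a′
    parallel-directions⇒≡ {a} {a′} a∥a′ =
      direction-injective (parallel-meet⇒≈ a∥a′ (O∈direction a) (O∈direction a′))

    transversal : Fin (suc n) → Fin (suc n)
    transversal zero = suc zero
    transversal (suc _) = zero

    direction-∦-transversal : ∀ a → ¬ Parallel (direction a) (direction (transversal a))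
    direction-∦-transversal zero ∥ with () ← parallel-directions⇒≡ {zero} {suc zero} ∥
    direction-∦-transversal (suc j) ∥ with () ← parallel-directions⇒≡ {suc j} {zero} ∥

    module Class (a : Fin (suc n)) =
      Transversal (direction a) (direction (transversal a)) (direction-∦-transversal a)

    class : Fin (suc n) → Fin n → Ln
    class a = Class.member a

    parallel-classes⇒≡ : ∀ {a b a′ b′} → Parallel (class a b) (class a′ b′) → a ≡ a′
    parallel-classes⇒≡ {a} {b} {a′} {b′} ∥ = parallel-directions⇒≡ (parallel-trans
      (Class.member-parallel a b) (parallel-trans ∥ (parallel-sym (Class.member-parallel a′ b′))))

    class-injective : ∀ a b a′ b′ → class a b ≈ class a′ b′ → a ≡ a′ × b ≡ b′
    class-injective a b a′ b′ b≈b′ with refl ← parallel-classes⇒≡ {a} {b} {a′} {b′} (inj₁ b≈b′) =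
      refl , Class.member-injective a b≈b′

    class-surjective : ∀ ℓ → ∃[ a ] ∃[ b ] (ℓ ≈ class a b)
    class-surjective ℓ with direction-of ℓ
    ... | a , a∥ℓ = a , Class.member-surjective a a∥ℓ

    class-parallel : ∀ a b a′ b′ → (Parallel (class a b) (class a′ b′) → a ≡ a′)
                                 × (a ≡ a′ → Parallel (class a b) (class a′ b′))
    class-parallel a b a′ b′ = parallel-classes⇒≡ , λ { refl →
      parallel-trans (parallel-sym (Class.member-parallel a b)) (Class.member-parallel a b′) }

  parallelClasses : Σ (Fin (suc n) → Fin n → Ln) λ L
    → (∀ a b a′ b′ → L a b ≈ L a′ b′ → a ≡ a′ × b ≡ b′)
    × (∀ ℓ → ∃[ a ] ∃[ b ] (ℓ ≈ L a b))
    × (∀ a b a′ b′ → (Parallel (L a b) (L a′ b′) → a ≡ a′)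
                     × (a ≡ a′ → Parallel (L a b) (L a′ b′)))
  parallelClasses = class , class-injective , class-surjective , class-parallel

  lineNumbering : Σ (Fin (n * n + n) → Ln) λ e
    → (∀ x y → e x ≈ e y → x ≡ y) × (∀ ℓ → ∃[ x ] (ℓ ≈ e x))
  lineNumbering = uncurry class ∘ to , numbering-injective , numbering-surjective
    where
    number : Fin (n * n + n) ↔ (Fin (suc n) × Fin n)
    number = subst (λ k → Fin k ↔ (Fin (suc n) × Fin n)) (+-comm n (n * n)) *↔×
    open Inverse number using (to; from; strictlyInverseˡ)

    numbering-injective : ∀ x y → uncurry class (to x) ≈ uncurry class (to y) → x ≡ y
    numbering-injective x y x≈y =
      Injection.injective (↔⇒↣ number) (×-≡,≡→≡ (class-injective _ _ _ _ x≈y))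

    numbering-surjective : ∀ ℓ → ∃[ x ] (ℓ ≈ uncurry class (to x))
    numbering-surjective ℓ with class-surjective ℓ
    ... | a , b , ℓ≈ab =
      from (a , b) , subst (λ ab → ℓ ≈ uncurry class ab) (sym (strictlyInverseˡ (a , b))) ℓ≈ab

SamePlane-isEquivalence : (F : Field) → IsEquivalence (PG4.SamePlane F)
SamePlane-isEquivalence F = record
  { refl = λ _ → id , id
  ; sym = λ π≡ρ P → swap (π≡ρ P)
  ; trans = λ π≡ρ ρ≡σ P → proj₁ (ρ≡σ P) ∘ proj₁ (π≡ρ P) , proj₂ (π≡ρ P) ∘ proj₂ (ρ≡σ P)
  }

module CPlaneGeometry (F : Field) (r : ℕ) (h : PG4.V F)
  (c : Fin (suc (suc r) * suc (suc r)) → PG4.Point F) (isC : PG4.Plane F → Set)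
  (arcs : ∀ π → isC π → Setting.MeetsInQArc F (suc (suc r)) h c isC π)
  (a2 : Setting.A2 F (suc (suc r)) h c isC)
  where

  open Setting F (suc (suc r)) h c isC

  ≈L-isEquivalence : IsEquivalence _≈L_
  ≈L-isEquivalence = On.isEquivalence proj₁ (SamePlane-isEquivalence F)

  I-resp-≈L : ∀ {i ℓ ℓ′} → ℓ ≈L ℓ′ → i I ℓ → i I ℓ′
  I-resp-≈L {i} ℓ≈ℓ′ = proj₁ (ℓ≈ℓ′ (c i))

  point : CLine → Fin (suc (suc r)) → Fin (suc (suc r) * suc (suc r))
  point (π , C) = proj₁ (arcs π C)

  point-injective : ∀ ℓ → Injective _≡_ _≡_ (point ℓ)
  point-injective (π , C) = proj₁ (proj₂ (arcs π C))

  point-on : ∀ ℓ j → point ℓ j I ℓ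
  point-on (π , C) = proj₁ (proj₂ (proj₂ (arcs π C)))

  point-surjective : ∀ ℓ i → i I ℓ → ∃[ j ] (point ℓ j ≡ i)
  point-surjective (π , C) = proj₁ (proj₂ (proj₂ (proj₂ (arcs π C))))

  join : ∀ i j → i ≢ j → ∃[ ℓ ] (i I ℓ × j I ℓ)
  join i j i≢j with a2 i j i≢j
  ... | π , C , i∈π , j∈π , _ = (π , C) , i∈π , j∈π

  join-unique : ∀ i j → i ≢ j → ∀ ℓ ℓ′ → i I ℓ → j I ℓ → i I ℓ′ → j I ℓ′ → ℓ ≈L ℓ′
  join-unique i j i≢j (ρ , Cρ) (ρ′ , Cρ′) i∈ρ j∈ρ i∈ρ′ j∈ρ′ with a2 i j i≢j
  ... | π , _ , _ , _ , unique =
    SamePlane.trans {ρ} {π} {ρ′} (SamePlane.sym {π} {ρ} (unique ρ Cρ i∈ρ j∈ρ))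
                                 (unique ρ′ Cρ′ i∈ρ′ j∈ρ′)
    where module SamePlane = IsEquivalence (SamePlane-isEquivalence F)

  open FiniteLinearSpace r _≈L_ ≈L-isEquivalence _I_ (λ {i ℓ ℓ′} → I-resp-≈L {i} {ℓ} {ℓ′})
    point point-injective point-on point-surjective join join-unique public
    using (isAffinePlane; parallelClasses; lineNumbering)

lemma3p1 : (F : Field) (q : ℕ) → HasOrder F q → Odd q → 7 ≤ q
    → (h : PG4.V F) → h ≢ PG4.𝟎 F
    → (c : Fin (q * q) → PG4.Point F)
    → (∀ i j → PG4.SamePoint F (c i) (c j) → i ≡ j)
    → (∀ i → PG4.Affine.Affine F h (c i))
    → (isC : PG4.Plane F → Set)
    → (∀ π ρ → PG4.SamePlane F π ρ → isC π → isC ρ)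
    → (∀ π → isC π → PG4.Affine.AffinePlane F h π)
    → Setting.A1 F q h c isC → Setting.A2 F q h c isC → Setting.A3 F q h c isC
    → Setting.IsAffinePlaneOfOrder F q h c isC q
      × Setting.NumberOfCPlanes F q h c isC
      × Setting.ParallelClasses F q h c isC
lemma3p1 F (suc (suc r)) _ _ (s≤s (s≤s _)) h _ c _ _ isC _ _ (arcs , _) a2 _ =
  isAffinePlane , lineNumbering , parallelClasses
  where open CPlaneGeometry F r h c isC arcs a2
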